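{- Let $k$ be a positive integer and let $G$ be a graph with a $k$-colouring $\beta$ and a Kempe frozen $(k+1)$-colouring $\gamma$. Let $x,y$ be nonadjacent vertices of $G$ with $\beta(x)\neq\beta(y)$ such that either (1) $\gamma(x)\neq\gamma(y)$, or (2) $\{x,y\}$ is a colour class of $\gamma$. Let $G'$ be the graph obtained from $G$ by adding two new vertices $u,v$ and the edges $vx$, $xy$, $yu$, and joining each of $u$ and $v$ to every vertex of $G-\{x,y\}$ (so $u,v$ are nonadjacent, $u$ is nonadjacent to $x$, and $v$ is nonadjacent to $y$). Then $G'$ is $(k+1)$-colourable and admits a Kempe frozen $(k+2)$-colouring, and so $\mathcal{C}_{k+2}(G')$ does not form a Kempe class. Furthermore: (3) if $\chi(G)=k$, then $\chi(G')=k+1$; (4) if $G$ is $2K_2$-free and, in case (1), there is no edge $rs$ of $G$ such that $\{r,s\}$ is anticomplete to $\{x,y\}$, then $G'$ is $2K_2$-free.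
   Context: All graphs are finite and simple. A $k$-colouring is a proper colouring with colours $1,\dots,k$; its colour classes are the nonempty sets of vertices of a given colour; $\mathcal{C}_k(G)$ is the set of all $k$-colourings of $G$ and $\chi(G)$ the chromatic number. A $k$-colouring is Kempe frozen if each of the $k$ colours is used on some vertex and for any two colours the subgraph induced by the union of the two corresponding colour classes is connected. A Kempe chain (for a colouring and two colours $a,b$) is a connected component of the subgraph induced by the vertices coloured $a$ or $b$; a Kempe swap interchanges $a$ and $b$ on one Kempe chain. Two colourings are Kempe equivalent if each can be obtained from the other by a sequence of Kempe swaps; a set of colourings forms a Kempe class if its members are pairwise Kempe equivalent. Two vertex sets are anticomplete if no edge has one end in each. $2K_2$ is the graph consisting of two disjoint edges; $G$ is $2K_2$-free if no induced subgraph is isomorphic to $2K_2$. -}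

module Defs where

open import Data.Nat using (ℕ; zero; suc; _≤_)
open import Data.Fin using (Fin; zero; suc; _≟_)
open import Data.Bool using (Bool; true; false; not; _∨_; _∧_)
open import Data.Product using (Σ; ∃; _×_; _,_)
open import Data.Sum using (_⊎_)
open import Relation.Nullary using (¬_; ⌊_⌋; yes; no)
open import Relation.Binary.PropositionalEquality using (_≡_; _≢_; refl; cong; cong₂)
import Relation.Binary.PropositionalEquality as P
import Data.Bool.Properties as BP
open import Data.Empty using (⊥-elim)
open import Relation.Binary.Construct.Closure.ReflexiveTransitive using (Star)

record Graph (n : ℕ) : Set where
  field
    adj    : Fin n → Fin n → Bool
    sym    : ∀ a b → adj a b ≡ adj b a
    irrefl : ∀ a → adj a a ≡ false
open Graph public

Colouring : ∀ {n} → Graph n → ℕ → Set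
Colouring {n} G k = Fin n → Fin k

Proper : ∀ {n} (G : Graph n) {k} → (Fin n → Fin k) → Set
Proper {n} G c = ∀ (a b : Fin n) → adj G a b ≡ true → c a ≢ c b

Colourable : ∀ {n} → Graph n → ℕ → Set
Colourable {n} G k = Σ (Fin n → Fin k) (λ c → Proper G c)

IsChromaticNumber : ∀ {n} → Graph n → ℕ → Set
IsChromaticNumber G k = Colourable G k × (∀ m → Colourable G m → k ≤ m)

-- Reachability inside the subgraph induced by a vertex set S
-- (a walk from p to q all of whose vertices after p lie in S).
data ReachIn {n} (G : Graph n) (S : Fin n → Set) : Fin n → Fin n → Set where
  here : ∀ {p} → ReachIn G S p p
  step : ∀ {p q r} → adj G p q ≡ true → S q → ReachIn G S q r → ReachIn G S p r

ConnectedIn : ∀ {n} → Graph n → (Fin n → Set) → Set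
ConnectedIn {n} G S = ∀ (p q : Fin n) → S p → S q → ReachIn G S p q

TwoColoured : ∀ {n k} → (Fin n → Fin k) → Fin k → Fin k → Fin n → Set
TwoColoured c a b z = c z ≡ a ⊎ c z ≡ b

KempeFrozen : ∀ {n} (G : Graph n) {k} → (Fin n → Fin k) → Set
KempeFrozen {n} G {k} c =
  Proper G c ×
  (∀ (a : Fin k) → ∃ λ (z : Fin n) → c z ≡ a) ×
  (∀ (a b : Fin k) → a ≢ b → ConnectedIn G (TwoColoured c a b))

swapCol : ∀ {k} → Fin k → Fin k → Fin k → Fin k
swapCol a b c with c ≟ a
... | yes _ = b
... | no _ with c ≟ b
...   | yes _ = a
...   | no _ = c

KempeSwap : ∀ {n} (G : Graph n) {k} → (Fin n → Fin k) → (Fin n → Fin k) → Set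
KempeSwap {n} G {k} c c' =
  Σ (Fin k) λ a → Σ (Fin k) λ b → Σ (Fin n) λ w →
    TwoColoured c a b w ×
    (∀ z → ReachIn G (TwoColoured c a b) w z → c' z ≡ swapCol a b (c z)) ×
    (∀ z → ¬ ReachIn G (TwoColoured c a b) w z → c' z ≡ c z)

KempeEquivalent : ∀ {n} (G : Graph n) {k} → (Fin n → Fin k) → (Fin n → Fin k) → Set
KempeEquivalent G = Star (KempeSwap G)

FormsKempeClass : ∀ {n} → Graph n → ℕ → Set
FormsKempeClass {n} G k =
  ∀ (c d : Fin n → Fin k) → Proper G c → Proper G d → KempeEquivalent G c d

IsColourClassPair : ∀ {n k} → (Fin n → Fin k) → Fin n → Fin n → Set
IsColourClassPair c x y = ∀ z → (c z ≡ c x → (z ≡ x ⊎ z ≡ y)) × ((z ≡ x ⊎ z ≡ y) → c z ≡ c x)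

TwoK2Free : ∀ {n} → Graph n → Set
TwoK2Free {n} G = ∀ (a b c d : Fin n) →
  ¬ (adj G a b ≡ true × adj G c d ≡ true ×
     adj G a c ≡ false × adj G a d ≡ false ×
     adj G b c ≡ false × adj G b d ≡ false)

-- Construction of G'. Vertex 0 = u, vertex 1 = v, vertex (2 + i) = vertex i of G.
_==_ : ∀ {n} → Fin n → Fin n → Bool
a == b = ⌊ a ≟ b ⌋

extAdj : ∀ {n} → Graph n → Fin n → Fin n →
         Fin (suc (suc n)) → Fin (suc (suc n)) → Bool
extAdj G x y zero zero = false
extAdj G x y zero (suc zero) = false
extAdj G x y (suc zero) zero = false
extAdj G x y (suc zero) (suc zero) = false
extAdj G x y zero (suc (suc w)) = not (w == x)
extAdj G x y (suc (suc w)) zero = not (w == x)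
extAdj G x y (suc zero) (suc (suc w)) = not (w == y)
extAdj G x y (suc (suc w)) (suc zero) = not (w == y)
extAdj G x y (suc (suc a)) (suc (suc b)) =
  adj G a b ∨ (not (a == b) ∧ ((a == x ∧ b == y) ∨ (a == y ∧ b == x)))
  -- plus the edge xy (the guard a ≠ b only matters if x = y, excluded in the theorem)

private
  ==-sym : ∀ {n} (a b : Fin n) → (a == b) ≡ (b == a)
  ==-sym a b with a ≟ b | b ≟ a
  ... | yes _ | yes _ = refl
  ... | no _ | no _ = refl
  ... | yes p | no q = ⊥-elim (q (P.sym p))
  ... | no p | yes q = ⊥-elim (p (P.sym q))

  ==-refl : ∀ {n} (a : Fin n) → (a == a) ≡ true
  ==-refl a with a ≟ a
  ... | yes _ = refl
  ... | no p = ⊥-elim (p refl)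

  ∨-swap : ∀ p q r s → ((p ∧ q) ∨ (r ∧ s)) ≡ ((s ∧ r) ∨ (q ∧ p))
  ∨-swap true true r s rewrite BP.∧-comm s r = BP.∨-comm true (r ∧ s)
  ∨-swap true false r s rewrite BP.∧-comm s r | BP.∨-identityʳ (r ∧ s) = refl
  ∨-swap false q r s rewrite BP.∧-comm s r | BP.∧-zeroʳ q | BP.∨-identityʳ (r ∧ s) = refl

extAdj-sym : ∀ {n} (G : Graph n) x y a b → extAdj G x y a b ≡ extAdj G x y b a
extAdj-sym G x y zero zero = refl
extAdj-sym G x y zero (suc zero) = refl
extAdj-sym G x y (suc zero) zero = refl
extAdj-sym G x y (suc zero) (suc zero) = refl
extAdj-sym G x y zero (suc (suc w)) = refl
extAdj-sym G x y (suc (suc w)) zero = refl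
extAdj-sym G x y (suc zero) (suc (suc w)) = refl
extAdj-sym G x y (suc (suc w)) (suc zero) = refl
extAdj-sym G x y (suc (suc a)) (suc (suc b))
  rewrite sym G a b | ==-sym a b | ==-sym a x | ==-sym b y | ==-sym a y | ==-sym b x
  = cong (λ t → adj G b a ∨ (not (b == a) ∧ t)) (∨-swap (x == a) (y == b) (y == a) (x == b))

extAdj-irrefl : ∀ {n} (G : Graph n) x y a → extAdj G x y a a ≡ false
extAdj-irrefl G x y zero = refl
extAdj-irrefl G x y (suc zero) = refl
extAdj-irrefl G x y (suc (suc a)) rewrite irrefl G a | ==-refl a = refl

extend : ∀ {n} → Graph n → Fin n → Fin n → Graph (suc (suc n))
extend G x y = record { adj = extAdj G x y ; sym = extAdj-sym G x y ; irrefl = extAdj-irrefl G x y }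

module Submission where

-- In a Kempe frozen colouring every vertex sees every other colour, so a
-- Kempe swap always exchanges two colours globally; Kempe equivalence
-- therefore preserves frozenness, and a frozen colouring is never Kempe
-- equivalent to one that misses a colour.  For G' the colouring
-- "u, v ↦ 0, w ↦ 1 + β w" is proper, and its shift by one misses colour 0.
-- A frozen (k+2)-colouring of G' comes from γ: in case (1) colour u and v
-- with the new colour, and in case (2) give u the colour of the class
-- {x, y} and put v and y into the new class.  Each new two-coloured
-- subgraph is connected through a hub adjacent to (almost) everything;
-- the remaining ones are copies of two-coloured subgraphs of G.
-- For χ: in a (m+1)-colouring of G' only x can share the colour of u and
-- only y that of v, so recolouring x like v frees a colour on G.
-- For 2K2-freeness: u and v miss only {v, x} and {u, y}, and the one new
-- edge xy inside G cannot lie in a 2K2 unless some edge of G is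
-- anticomplete to {x, y}; in case (2) every vertex off the colour class
-- {x, y} of the frozen γ has a neighbour in it.

open import Defs hiding (sym)
open import Data.Nat using (ℕ; suc; _≤_; s≤s)
open import Data.Fin using (Fin; zero; suc; _≟_; punchOut)
open import Data.Fin.Properties using (suc-injective; punchOut-injective; 0≢1+n)
open import Data.Bool using (true; false; not; T; _∧_)
open import Data.Bool.Properties using (T-≡; T-not-≡; T-∨; T-∧; not-injective; not-¬; ∨-conicalˡ)
open import Data.Product using (Σ; ∃; _×_; _,_; proj₁; proj₂)
import Data.Product as Product
open import Data.Sum using (_⊎_; inj₁; inj₂; [_,_]; [_,_]′)
import Data.Sum as Sum
open import Data.Empty using (⊥-elim)
open import Function using (_∘_; flip)
open import Function.Bundles using (Equivalence)
open import Relation.Nullary using (¬_; yes; no; Dec)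
open import Relation.Nullary.Decidable
  using (toWitness; fromWitness; toWitnessFalse; fromWitnessFalse; decidable-stable)
open import Relation.Binary.PropositionalEquality using (_≡_; _≢_; refl; sym; trans; cong; ≢-sym)
open import Relation.Binary.Construct.Closure.ReflexiveTransitive using (ε; _◅_)

open Equivalence using (to; from)

infix 4 _⊢_∼_ _⊢_≁_

_⊢_∼_ : ∀ {n} → Graph n → Fin n → Fin n → Set
H ⊢ a ∼ b = adj H a b ≡ true

_⊢_≁_ : ∀ {n} → Graph n → Fin n → Fin n → Set
H ⊢ a ≁ b = adj H a b ≡ false

∼-sym : ∀ {n} (H : Graph n) {a b} → H ⊢ a ∼ b → H ⊢ b ∼ a
∼-sym H {a} {b} = trans (Graph.sym H b a)

≁-sym : ∀ {n} (H : Graph n) {a b} → H ⊢ a ≁ b → H ⊢ b ≁ a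
≁-sym H {a} {b} = trans (Graph.sym H b a)

T==⇒≡ : ∀ {n} {a b : Fin n} → T (a == b) → a ≡ b
T==⇒≡ {a = a} {b} = toWitness {a? = a ≟ b}

==⇒≡ : ∀ {n} {a b : Fin n} → (a == b) ≡ true → a ≡ b
==⇒≡ = T==⇒≡ ∘ from T-≡

==-refl : ∀ {n} (a : Fin n) → (a == a) ≡ true
==-refl a = to T-≡ (fromWitness refl)

≢⇒==false : ∀ {n} {a b : Fin n} → a ≢ b → (a == b) ≡ false
≢⇒==false = to T-not-≡ ∘ fromWitnessFalse

not==⇒≢ : ∀ {n} {a b : Fin n} → not (a == b) ≡ true → a ≢ b
not==⇒≢ {a = a} {b} = toWitnessFalse {a? = a ≟ b} ∘ from T-≡

-- Walks inside induced subgraphs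

module _ {m} (H : Graph m) where

  reach-trans : ∀ {S p q r} → ReachIn H S p q → ReachIn H S q r → ReachIn H S p r
  reach-trans here          q⇝r = q⇝r
  reach-trans (step e s p⇝q) q⇝r = step e s (reach-trans p⇝q q⇝r)

  reach-sym : ∀ {S p q} → S p → ReachIn H S p q → ReachIn H S q p
  reach-sym sp here = here
  reach-sym sp (step e sq q⇝r) = reach-trans (reach-sym sq q⇝r) (step (∼-sym H e) sp here)

  reach-mono : ∀ {S T : Fin m → Set} {p q} → (∀ z → S z → T z) → ReachIn H S p q → ReachIn H T p q
  reach-mono S⊆T here = here
  reach-mono S⊆T (step e s p⇝q) = step e (S⊆T _ s) (reach-mono S⊆T p⇝q)

  reach-edge : ∀ {S : Fin m → Set} {p q} → H ⊢ p ∼ q → S q → ReachIn H S p q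
  reach-edge e s = step e s here

  hub⇒connected : ∀ {S : Fin m → Set} h → S h → (∀ p → S p → ReachIn H S h p) → ConnectedIn H S
  hub⇒connected h sh h⇝ p q sp sq = reach-trans (reach-sym sh (h⇝ p sp)) (h⇝ q sq)

  connected-twoColoured-comm : ∀ {k} (c : Fin m → Fin k) a b →
    ConnectedIn H (TwoColoured c a b) → ConnectedIn H (TwoColoured c b a)
  connected-twoColoured-comm c a b conn p q sp sq =
    reach-mono comm (conn p q (comm p sp) (comm q sq))
    where
    comm : ∀ {a b} z → TwoColoured c a b z → TwoColoured c b a z
    comm z = [ inj₂ , inj₁ ]

reach-map : ∀ {m m'} {H : Graph m} {H' : Graph m'} (f : Fin m → Fin m')
  {S : Fin m → Set} {T : Fin m' → Set} →
  (∀ {a b} → H ⊢ a ∼ b → H' ⊢ f a ∼ f b) → (∀ w → S w → T (f w)) →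
  ∀ {p q} → ReachIn H S p q → ReachIn H' T (f p) (f q)
reach-map f hom S⇒T here = here
reach-map f hom S⇒T (step e s p⇝q) = step (hom e) (S⇒T _ s) (reach-map f hom S⇒T p⇝q)

-- Kempe frozen colourings

module _ {K : ℕ} where

  swapCol-left : ∀ (a b : Fin K) → swapCol a b a ≡ b
  swapCol-left a b with a ≟ a
  ... | yes _  = refl
  ... | no a≢a = ⊥-elim (a≢a refl)

  swapCol-right : ∀ (a b : Fin K) → swapCol a b b ≡ a
  swapCol-right a b with b ≟ a
  ... | yes b≡a = b≡a
  ... | no _ with b ≟ b
  ...   | yes _  = refl
  ...   | no b≢b = ⊥-elim (b≢b refl)

  swapCol-other : ∀ (a b t : Fin K) → t ≢ a → t ≢ b → swapCol a b t ≡ t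
  swapCol-other a b t t≢a t≢b with t ≟ a
  ... | yes t≡a = ⊥-elim (t≢a t≡a)
  ... | no _ with t ≟ b
  ...   | yes t≡b = ⊥-elim (t≢b t≡b)
  ...   | no _    = refl

  swapCol-involutive : ∀ (a b t : Fin K) → swapCol a b (swapCol a b t) ≡ t
  swapCol-involutive a b t = cases (t ≟ a) (t ≟ b)
    where
    cases : Dec (t ≡ a) → Dec (t ≡ b) → swapCol a b (swapCol a b t) ≡ t
    cases (yes refl) _ = trans (cong (swapCol t b) (swapCol-left t b)) (swapCol-right t b)
    cases (no _) (yes refl) = trans (cong (swapCol a t) (swapCol-right a t)) (swapCol-left a t)
    cases (no t≢a) (no t≢b) =
      trans (cong (swapCol a b) (swapCol-other a b t t≢a t≢b)) (swapCol-other a b t t≢a t≢b)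

module _ {m} {H : Graph m} {K : ℕ} where

  frozen⇒neighbour : ∀ {c : Fin m → Fin K} → KempeFrozen H c →
    ∀ z b → c z ≢ b → ∃ λ q → H ⊢ z ∼ q × c q ≡ b
  frozen⇒neighbour {c} (proper , onto , conn) z b cz≢b with onto b
  ... | w , cw≡b with conn (c z) b cz≢b z w (inj₁ refl) (inj₂ cw≡b)
  ...   | here = ⊥-elim (cz≢b cw≡b)
  ...   | step {q = q} z∼q (inj₁ cq≡cz) _ = ⊥-elim (proper z q z∼q (sym cq≡cz))
  ...   | step {q = q} z∼q (inj₂ cq≡b) _ = q , z∼q , cq≡b

  frozen-recolour : (σ : Fin K → Fin K) → (∀ t → σ (σ t) ≡ t) →
    (c c' : Fin m → Fin K) → (∀ z → c' z ≡ σ (c z)) → KempeFrozen H c → KempeFrozen H c'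
  frozen-recolour σ σσ c c' c'≡σc (proper , onto , conn) = proper' , onto' , conn'
    where
    σ-injective : ∀ {s t} → σ s ≡ σ t → s ≡ t
    σ-injective {s} {t} e = trans (sym (σσ s)) (trans (cong σ e) (σσ t))
    c'⇒c : ∀ {z t} → c' z ≡ t → c z ≡ σ t
    c'⇒c {z} e = trans (sym (σσ (c z))) (cong σ (trans (sym (c'≡σc z)) e))
    c⇒c' : ∀ {z t} → c z ≡ σ t → c' z ≡ t
    c⇒c' {z} {t} e = trans (c'≡σc z) (trans (cong σ e) (σσ t))
    proper' : Proper H c'
    proper' a b a∼b e = proper a b a∼b (σ-injective (trans (sym (c'≡σc a)) (trans e (c'≡σc b))))
    onto' : ∀ t → ∃ λ z → c' z ≡ t
    onto' t = Product.map₂ c⇒c' (onto (σ t))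
    conn' : ∀ a b → a ≢ b → ConnectedIn H (TwoColoured c' a b)
    conn' a b a≢b p q sp sq =
      reach-mono H (λ _ → Sum.map c⇒c' c⇒c')
        (conn (σ a) (σ b) (a≢b ∘ σ-injective) p q (Sum.map c'⇒c c'⇒c sp) (Sum.map c'⇒c c'⇒c sq))

  -- The Kempe chain of a frozen colouring is its whole (a,b)-subgraph.
  kempeSwap-global : ∀ {c c' : Fin m → Fin K} → KempeFrozen H c → (s : KempeSwap H c c') →
    let (a , b , _) = s in ∀ z → c' z ≡ swapCol a b (c z)
  kempeSwap-global {c} {c'} (_ , _ , conn) (a , b , w , w-ab , swapped , unchanged) z =
    decidable-stable (c' z ≟ swapCol a b (c z)) λ c'z≢ →
      let unreached = λ r → c'z≢ (swapped z r) in
      c'z≢ (trans (unchanged z unreached) (sym (fixed unreached (a ≟ b) (c z ≟ a) (c z ≟ b))))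
    where
    fixed : ¬ ReachIn H (TwoColoured c a b) w z → Dec (a ≡ b) → Dec (c z ≡ a) → Dec (c z ≡ b) →
      swapCol a b (c z) ≡ c z
    fixed _ (yes refl) (yes cz≡a) _ = trans (cong (swapCol a a) cz≡a) (trans (swapCol-left a a) (sym cz≡a))
    fixed _ (yes refl) (no cz≢a) _ = swapCol-other a a (c z) cz≢a cz≢a
    fixed ¬w⇝z (no a≢b) (yes cz≡a) _ = ⊥-elim (¬w⇝z (conn a b a≢b w z w-ab (inj₁ cz≡a)))
    fixed ¬w⇝z (no a≢b) (no _) (yes cz≡b) = ⊥-elim (¬w⇝z (conn a b a≢b w z w-ab (inj₂ cz≡b)))
    fixed _ (no _) (no cz≢a) (no cz≢b) = swapCol-other a b (c z) cz≢a cz≢b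

  kempeEquivalent-frozen : ∀ {c d : Fin m → Fin K} →
    KempeFrozen H c → KempeEquivalent H c d → KempeFrozen H d
  kempeEquivalent-frozen frozen ε = frozen
  kempeEquivalent-frozen {c} frozen (s@(a , b , _) ◅ rest) =
    kempeEquivalent-frozen (frozen-recolour (swapCol a b) (swapCol-involutive a b) c _
                              (kempeSwap-global frozen s) frozen) rest

  frozen⇒¬kempeClass : ∀ {δ : Fin m → Fin K} → KempeFrozen H δ →
    (c : Fin m → Fin K) → Proper H c →
    ∀ a → (∀ z → c z ≢ a) → ¬ FormsKempeClass H K
  frozen⇒¬kempeClass {δ} frozen c proper a missing kempeClass
    with proj₁ (proj₂ (kempeEquivalent-frozen frozen (kempeClass δ c (proj₁ frozen) proper))) a
  ... | z , cz≡a = missing z cz≡a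

missing-colour⇒colourable : ∀ {n k} (H : Graph n) (c : Fin n → Fin (suc k)) → Proper H c →
  ∀ a → (∀ z → a ≢ c z) → Colourable H k
missing-colour⇒colourable H c proper a missing =
  (λ z → punchOut (missing z)) ,
  λ p q p∼q e → proper p q p∼q (punchOut-injective (missing p) (missing q) e)

-- Colour classes and 2K2s

classPair⇒dominating : ∀ {n k} {G : Graph n} {γ : Fin n → Fin k} {x y} →
  KempeFrozen G γ → IsColourClassPair γ x y → ∀ r → r ≢ x → r ≢ y → G ⊢ r ∼ x ⊎ G ⊢ r ∼ y
classPair⇒dominating {γ = γ} {x} frozen class r r≢x r≢y
  with frozen⇒neighbour frozen r (γ x) (λ e → [ r≢x , r≢y ] (proj₁ (class r) e))
... | q , r∼q , γq≡γx with proj₁ (class q) γq≡γx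
...   | inj₁ refl = inj₁ r∼q
...   | inj₂ refl = inj₂ r∼q

AnticompleteTo : ∀ {n} → Graph n → Fin n → Fin n → Fin n → Fin n → Set
AnticompleteTo H r s a b = H ⊢ r ≁ a × H ⊢ r ≁ b × H ⊢ s ≁ a × H ⊢ s ≁ b

NoEdgeAnticompleteTo : ∀ {n} → Graph n → Fin n → Fin n → Set
NoEdgeAnticompleteTo G x y = ∀ r s → G ⊢ r ∼ s → ¬ AnticompleteTo G r s x y

classPair⇒noEdgeAnticomplete : ∀ {n k} {G : Graph n} {γ : Fin n → Fin k} {x y} →
  KempeFrozen G γ → IsColourClassPair γ x y → NoEdgeAnticompleteTo G x y
classPair⇒noEdgeAnticomplete {G = G} {x = x} {y} frozen class r s r∼s (r≁x , r≁y , s≁x , s≁y) =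
  [ (λ r∼x → not-¬ r∼x r≁x) , (λ r∼y → not-¬ r∼y r≁y) ] (classPair⇒dominating frozen class r r≢x r≢y)
  where
  r≢x : r ≢ x
  r≢x refl = not-¬ (∼-sym G r∼s) s≁x
  r≢y : r ≢ y
  r≢y refl = not-¬ (∼-sym G r∼s) s≁y

twoColoured-connected-suc : ∀ {m K} (H : Graph m) (c : Fin m → Fin (suc K)) →
  (∀ b → ConnectedIn H (TwoColoured c zero (suc b))) →
  (∀ a b → a ≢ b → ConnectedIn H (TwoColoured c (suc a) (suc b))) →
  ∀ a b → a ≢ b → ConnectedIn H (TwoColoured c a b)
twoColoured-connected-suc H c new old zero zero 0≢0 = ⊥-elim (0≢0 refl)
twoColoured-connected-suc H c new old zero (suc b) _ = new b
twoColoured-connected-suc H c new old (suc a) zero _ = connected-twoColoured-comm H c zero (suc a) (new a)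
twoColoured-connected-suc H c new old (suc a) (suc b) a≢b = old a b (a≢b ∘ cong suc)

record Induced2K2 {n} (H : Graph n) (a b c d : Fin n) : Set where
  constructor induced2K2
  field
    a∼b : H ⊢ a ∼ b
    c∼d : H ⊢ c ∼ d
    a≁c : H ⊢ a ≁ c
    a≁d : H ⊢ a ≁ d
    b≁c : H ⊢ b ≁ c
    b≁d : H ⊢ b ≁ d

module _ {n} {H : Graph n} where

  ¬induced2K2⇒twoK2Free : (∀ a b c d → ¬ Induced2K2 H a b c d) → TwoK2Free H
  ¬induced2K2⇒twoK2Free none a b c d (a∼b , c∼d , a≁c , a≁d , b≁c , b≁d) =
    none a b c d (induced2K2 a∼b c∼d a≁c a≁d b≁c b≁d)

module _ {n} {H : Graph n} {a b c d : Fin n} where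

  induced2K2-flip : Induced2K2 H a b c d → Induced2K2 H b a c d
  induced2K2-flip (induced2K2 a∼b c∼d a≁c a≁d b≁c b≁d) = induced2K2 (∼-sym H a∼b) c∼d b≁c b≁d a≁c a≁d

  induced2K2-swap : Induced2K2 H a b c d → Induced2K2 H c d a b
  induced2K2-swap (induced2K2 a∼b c∼d a≁c a≁d b≁c b≁d) =
    induced2K2 c∼d a∼b (≁-sym H a≁c) (≁-sym H b≁c) (≁-sym H a≁d) (≁-sym H b≁d)

  induced2K2⇒anticomplete : Induced2K2 H a b c d → AnticompleteTo H c d a b
  induced2K2⇒anticomplete (induced2K2 _ _ a≁c a≁d b≁c b≁d) =
    ≁-sym H a≁c , ≁-sym H b≁c , ≁-sym H a≁d , ≁-sym H b≁d

-- The graph G'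

pattern u = zero
pattern v = suc zero
pattern ⇑_ w = suc (suc w)

module Extension {n} (G : Graph n) {x y : Fin n} (x≢y : x ≢ y) (x≁y : G ⊢ x ≁ y) where

  G' : Graph (suc (suc n))
  G' = extend G x y

  IsXY : Fin n → Fin n → Set
  IsXY a b = (a ≡ x × b ≡ y) ⊎ (a ≡ y × b ≡ x)

  ⇑-adj : ∀ {a b} → G ⊢ a ∼ b → G' ⊢ ⇑ a ∼ ⇑ b
  ⇑-adj a∼b rewrite a∼b = refl

  ⇑-nonadj⁻ : ∀ {a b} → G' ⊢ ⇑ a ≁ ⇑ b → G ⊢ a ≁ b
  ⇑-nonadj⁻ = ∨-conicalˡ _ _

  ⇑-adj⁻ : ∀ {a b} → G' ⊢ ⇑ a ∼ ⇑ b → G ⊢ a ∼ b ⊎ IsXY a b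
  ⇑-adj⁻ a∼b with to T-∨ (from T-≡ a∼b)
  ... | inj₁ old = inj₁ (to T-≡ old)
  ... | inj₂ new = inj₂ (Sum.map both both (to T-∨ (proj₂ (to T-∧ new))))
    where
    both : ∀ {a b c d : Fin n} → T ((a == c) ∧ (b == d)) → a ≡ c × b ≡ d
    both = Product.map T==⇒≡ T==⇒≡ ∘ to T-∧

  xy-adj : G' ⊢ ⇑ x ∼ ⇑ y
  xy-adj rewrite x≁y | ≢⇒==false x≢y | ==-refl x | ==-refl y = refl

  yx-adj : G' ⊢ ⇑ y ∼ ⇑ x
  yx-adj = ∼-sym G' {⇑ x} {⇑ y} xy-adj

  u∼⇑ : ∀ {w} → w ≢ x → G' ⊢ u ∼ ⇑ w
  u∼⇑ = cong not ∘ ≢⇒==false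

  u∼⇑⁻ : ∀ {w} → G' ⊢ u ∼ ⇑ w → w ≢ x
  u∼⇑⁻ = not==⇒≢

  u≁⇑⁻ : ∀ {w} → G' ⊢ u ≁ ⇑ w → w ≡ x
  u≁⇑⁻ = ==⇒≡ ∘ not-injective

  v∼⇑ : ∀ {w} → w ≢ y → G' ⊢ v ∼ ⇑ w
  v∼⇑ = cong not ∘ ≢⇒==false

  v∼⇑⁻ : ∀ {w} → G' ⊢ v ∼ ⇑ w → w ≢ y
  v∼⇑⁻ = not==⇒≢

  v≁⇑⁻ : ∀ {w} → G' ⊢ v ≁ ⇑ w → w ≡ y
  v≁⇑⁻ = ==⇒≡ ∘ not-injective

  x-neighbour-outside : ∀ {q} → G ⊢ x ∼ q → q ≢ x × q ≢ y
  x-neighbour-outside x∼q = (λ { refl → not-¬ x∼q (irrefl G x) }) , (λ { refl → not-¬ x∼q x≁y })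

  y-neighbour-outside : ∀ {q} → G ⊢ y ∼ q → q ≢ x × q ≢ y
  y-neighbour-outside y∼q = (λ { refl → not-¬ y∼q (≁-sym G x≁y) }) , (λ { refl → not-¬ y∼q (irrefl G y) })

  connected-lift : ∀ {S : Fin n → Set} {T : Fin (suc (suc n)) → Set} → ¬ T u → ¬ T v →
    (∀ w → T (⇑ w) → S w) → (∀ w → S w → T (⇑ w)) → ConnectedIn G S → ConnectedIn G' T
  connected-lift ¬Tu ¬Tv down up conn u _ Tu _ = ⊥-elim (¬Tu Tu)
  connected-lift ¬Tu ¬Tv down up conn v _ Tv _ = ⊥-elim (¬Tv Tv)
  connected-lift ¬Tu ¬Tv down up conn (⇑ p) u _ Tu = ⊥-elim (¬Tu Tu)
  connected-lift ¬Tu ¬Tv down up conn (⇑ p) v _ Tv = ⊥-elim (¬Tv Tv)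
  connected-lift ¬Tu ¬Tv down up conn (⇑ p) (⇑ q) Tp Tq =
    reach-map (λ w → ⇑ w) ⇑-adj up (conn p q (down p Tp) (down q Tq))

  lift₀ : ∀ {K} → (Fin n → Fin K) → Fin (suc (suc n)) → Fin (suc K)
  lift₀ c u = zero
  lift₀ c v = zero
  lift₀ c (⇑ w) = suc (c w)

  lift₀-proper : ∀ {K} {c : Fin n → Fin K} → Proper G c → c x ≢ c y → Proper G' (lift₀ c)
  lift₀-proper _ _ u (⇑ _) _ = λ ()
  lift₀-proper _ _ v (⇑ _) _ = λ ()
  lift₀-proper _ _ (⇑ _) u _ = λ ()
  lift₀-proper _ _ (⇑ _) v _ = λ ()
  lift₀-proper proper cx≢cy (⇑ a) (⇑ b) a∼b with ⇑-adj⁻ a∼b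
  ... | inj₁ a∼b' = proper a b a∼b' ∘ suc-injective
  ... | inj₂ (inj₁ (refl , refl)) = cx≢cy ∘ suc-injective
  ... | inj₂ (inj₂ (refl , refl)) = cx≢cy ∘ sym ∘ suc-injective

  module _ {K} {γ : Fin n → Fin K} (frozen : KempeFrozen G γ) (γx≢γy : γ x ≢ γ y) where

    private
      proper = proj₁ frozen
      onto = proj₁ (proj₂ frozen)
      conn = proj₂ (proj₂ frozen)

    colour-outside-xy : ∀ b → ∃ λ w → γ w ≡ b × w ≢ x × w ≢ y
    colour-outside-xy b with b ≟ γ x | b ≟ γ y
    ... | yes refl | _ with frozen⇒neighbour frozen y (γ x) (γx≢γy ∘ sym)
    ...   | q , y∼q , γq≡γx = q , γq≡γx , y-neighbour-outside y∼q
    colour-outside-xy b | no _ | yes refl with frozen⇒neighbour frozen x (γ y) γx≢γy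
    ...   | q , x∼q , γq≡γy = q , γq≡γy , x-neighbour-outside x∼q
    colour-outside-xy b | no b≢γx | no b≢γy with onto b
    ...   | w , γw≡b = w , γw≡b , (λ { refl → b≢γx (sym γw≡b) }) , (λ { refl → b≢γy (sym γw≡b) })

    connected-lift₀-new : ∀ b → ConnectedIn G' (TwoColoured (lift₀ γ) zero (suc b))
    connected-lift₀-new b with colour-outside-xy b
    ... | h , γh≡b , h≢x , h≢y = hub⇒connected G' (⇑ h) (inj₂ (cong suc γh≡b)) reach
      where
      S = TwoColoured (lift₀ γ) zero (suc b)
      reach : ∀ p → S p → ReachIn G' S (⇑ h) p
      reach u _ = reach-edge G' (u∼⇑ h≢x) (inj₁ refl)
      reach v _ = reach-edge G' (v∼⇑ h≢y) (inj₁ refl)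
      reach (⇑ w) Sw with w ≟ x
      ... | yes refl = step {q = v} (v∼⇑ h≢y) (inj₁ refl) (reach-edge G' (v∼⇑ x≢y) Sw)
      ... | no w≢x = step {q = u} (u∼⇑ h≢x) (inj₁ refl) (reach-edge G' (u∼⇑ w≢x) Sw)

    frozen-lift₀ : KempeFrozen G' (lift₀ γ)
    frozen-lift₀ =
      lift₀-proper proper γx≢γy ,
      (λ { zero → u , refl ; (suc b) → Product.map (λ w → ⇑ w) (cong suc) (onto b) }) ,
      twoColoured-connected-suc G' (lift₀ γ) connected-lift₀-new λ a b a≢b →
        connected-lift [ (λ ()) , (λ ()) ] [ (λ ()) , (λ ()) ]
          (λ _ → Sum.map suc-injective suc-injective) (λ _ → Sum.map (cong suc) (cong suc))
          (conn a b a≢b)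

  classColouring : ∀ {K} → (Fin n → Fin K) → Fin (suc (suc n)) → Fin (suc K)
  classColouring c u = suc (c x)
  classColouring c v = zero
  classColouring c (⇑ w) with w ≟ y
  ... | yes _ = zero
  ... | no _ = suc (c w)

  module _ {K} {γ : Fin n → Fin K} (frozen : KempeFrozen G γ) (class : IsColourClassPair γ x y) where

    private
      proper = proj₁ frozen
      onto = proj₁ (proj₂ frozen)
      conn = proj₂ (proj₂ frozen)
      δ = classColouring γ

    γy≡γx : γ y ≡ γ x
    γy≡γx = proj₂ (class y) (inj₂ refl)

    γ-outside : ∀ {w} → w ≢ x → w ≢ y → γ w ≢ γ x
    γ-outside w≢x w≢y = [ w≢x , w≢y ] ∘ proj₁ (class _)

    δ-y : δ (⇑ y) ≡ zero
    δ-y with y ≟ y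
    ... | yes _ = refl
    ... | no y≢y = ⊥-elim (y≢y refl)

    δ-⇑ : ∀ {w} → w ≢ y → δ (⇑ w) ≡ suc (γ w)
    δ-⇑ {w} w≢y with w ≟ y
    ... | yes w≡y = ⊥-elim (w≢y w≡y)
    ... | no _ = refl

    δ-⇑⁻ : ∀ {w b} → δ (⇑ w) ≡ suc b → γ w ≡ b × w ≢ y
    δ-⇑⁻ {w} e with w ≟ y
    ... | no w≢y = suc-injective e , w≢y

    δ-⇑-colour : ∀ {w b} → w ≢ y → γ w ≡ b → δ (⇑ w) ≡ suc b
    δ-⇑-colour w≢y γw≡b = trans (δ-⇑ w≢y) (cong suc γw≡b)

    δ-⇑-separated : ∀ {a b} → G ⊢ a ∼ b ⊎ IsXY a b → δ (⇑ a) ≢ δ (⇑ b)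
    δ-⇑-separated (inj₂ (inj₁ (refl , refl))) e = 0≢1+n (trans (sym δ-y) (trans (sym e) (δ-⇑ x≢y)))
    δ-⇑-separated (inj₂ (inj₂ (refl , refl))) e = 0≢1+n (trans (sym δ-y) (trans e (δ-⇑ x≢y)))
    δ-⇑-separated {a} {b} (inj₁ a∼b) with a ≟ y | b ≟ y
    ... | yes refl | yes refl = ⊥-elim (not-¬ a∼b (irrefl G a))
    ... | yes refl | no _ = λ ()
    ... | no _ | yes refl = λ ()
    ... | no _ | no _ = proper a b a∼b ∘ suc-injective

    classColouring-proper : Proper G' δ
    classColouring-proper u (⇑ w) u∼w with w ≟ y
    ... | yes refl = λ ()
    ... | no w≢y = γ-outside (u∼⇑⁻ u∼w) w≢y ∘ sym ∘ suc-injective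
    classColouring-proper (⇑ w) u w∼u = ≢-sym (classColouring-proper u (⇑ w) w∼u)
    classColouring-proper v (⇑ w) v∼w = 0≢1+n ∘ flip trans (δ-⇑ (v∼⇑⁻ v∼w))
    classColouring-proper (⇑ w) v w∼v = ≢-sym (classColouring-proper v (⇑ w) w∼v)
    classColouring-proper (⇑ a) (⇑ b) a∼b = δ-⇑-separated (⇑-adj⁻ a∼b)

    classColouring-onto : ∀ t → ∃ λ z → δ z ≡ t
    classColouring-onto zero = v , refl
    classColouring-onto (suc b) with onto b
    ... | w , γw≡b with w ≟ y
    ...   | yes refl = u , cong suc (trans (sym γy≡γx) γw≡b)
    ...   | no w≢y = ⇑ w , δ-⇑-colour w≢y γw≡b

    connected-class-new : ConnectedIn G' (TwoColoured δ zero (suc (γ x)))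
    connected-class-new = hub⇒connected G' (⇑ x) (inj₂ (δ-⇑ x≢y)) reach
      where
      S = TwoColoured δ zero (suc (γ x))
      reach : ∀ p → S p → ReachIn G' S (⇑ x) p
      reach u Su = step {q = ⇑ y} xy-adj (inj₁ δ-y) (reach-edge G' (u∼⇑ (≢-sym x≢y)) Su)
      reach v Sv = reach-edge G' (v∼⇑ x≢y) Sv
      reach (⇑ w) = reach-⇑ (w ≟ y) (w ≟ x)
        where
        reach-⇑ : Dec (w ≡ y) → Dec (w ≡ x) → S (⇑ w) → ReachIn G' S (⇑ x) (⇑ w)
        reach-⇑ (yes refl) _ Sw = reach-edge G' xy-adj Sw
        reach-⇑ (no _) (yes refl) _ = here
        reach-⇑ (no w≢y) (no w≢x) Sw =
          ⊥-elim ([ (λ e → 0≢1+n (trans (sym e) (δ-⇑ w≢y))) , γ-outside w≢x w≢y ∘ proj₁ ∘ δ-⇑⁻ ] Sw)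

    connected-class-v : ∀ b → b ≢ γ x → ConnectedIn G' (TwoColoured δ zero (suc b))
    connected-class-v b b≢γx with frozen⇒neighbour frozen y b (λ γy≡b → b≢γx (trans (sym γy≡b) γy≡γx))
    ... | q , y∼q , γq≡b = hub⇒connected G' v (inj₁ refl) reach
      where
      S = TwoColoured δ zero (suc b)
      q≢y = proj₂ (y-neighbour-outside y∼q)
      reach : ∀ p → S p → ReachIn G' S v p
      reach u Su = ⊥-elim ([ (λ ()) , b≢γx ∘ sym ∘ suc-injective ] Su)
      reach v _ = here
      reach (⇑ w) = reach-⇑ (w ≟ y)
        where
        reach-⇑ : Dec (w ≡ y) → S (⇑ w) → ReachIn G' S v (⇑ w)
        reach-⇑ (yes refl) Sw =
          step {q = ⇑ q} (v∼⇑ q≢y) (inj₂ (δ-⇑-colour q≢y γq≡b)) (reach-edge G' (⇑-adj (∼-sym G y∼q)) Sw)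
        reach-⇑ (no w≢y) Sw = reach-edge G' (v∼⇑ w≢y) Sw

    connected-class-u : ∀ b → b ≢ γ x → ConnectedIn G' (TwoColoured δ (suc (γ x)) (suc b))
    connected-class-u b b≢γx with frozen⇒neighbour frozen x b (b≢γx ∘ sym)
    ... | q , x∼q , γq≡b = hub⇒connected G' u (inj₁ refl) reach
      where
      S = TwoColoured δ (suc (γ x)) (suc b)
      q-outside = x-neighbour-outside x∼q
      reach : ∀ p → S p → ReachIn G' S u p
      reach u _ = here
      reach v Sv = ⊥-elim ([ (λ ()) , (λ ()) ] Sv)
      reach (⇑ w) Sw with w ≟ x
      ... | yes refl = step {q = ⇑ q} (u∼⇑ (proj₁ q-outside)) (inj₂ (δ-⇑-colour (proj₂ q-outside) γq≡b))
                         (reach-edge G' (⇑-adj (∼-sym G x∼q)) Sw)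
      ... | no w≢x = reach-edge G' (u∼⇑ w≢x) Sw

    connected-class-old : ∀ a b → a ≢ γ x → b ≢ γ x → a ≢ b → ConnectedIn G' (TwoColoured δ (suc a) (suc b))
    connected-class-old a b a≢γx b≢γx a≢b =
      connected-lift [ a≢γx ∘ sym ∘ suc-injective , b≢γx ∘ sym ∘ suc-injective ] [ (λ ()) , (λ ()) ]
        (λ _ → Sum.map (proj₁ ∘ δ-⇑⁻) (proj₁ ∘ δ-⇑⁻)) (λ w → Sum.map (up a≢γx) (up b≢γx))
        (conn a b a≢b)
      where
      up : ∀ {w c} → c ≢ γ x → γ w ≡ c → δ (⇑ w) ≡ suc c
      up c≢γx γw≡c = δ-⇑-colour (λ { refl → c≢γx (trans (sym γw≡c) γy≡γx) }) γw≡c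

    frozen-classColouring : KempeFrozen G' δ
    frozen-classColouring =
      classColouring-proper , classColouring-onto ,
      twoColoured-connected-suc G' δ new old
      where
      new : ∀ b → ConnectedIn G' (TwoColoured δ zero (suc b))
      new b with b ≟ γ x
      ... | yes refl = connected-class-new
      ... | no b≢γx = connected-class-v b b≢γx
      old : ∀ a b → a ≢ b → ConnectedIn G' (TwoColoured δ (suc a) (suc b))
      old a b a≢b with a ≟ γ x | b ≟ γ x
      ... | yes refl | yes refl = ⊥-elim (a≢b refl)
      ... | yes refl | no b≢γx = connected-class-u b b≢γx
      ... | no a≢γx | yes refl = connected-twoColoured-comm G' δ (suc b) (suc a) (connected-class-u a a≢γx)
      ... | no a≢γx | no b≢γx = connected-class-old a b a≢γx b≢γx a≢b

  module _ {m} (c : Fin (suc (suc n)) → Fin (suc m)) (proper : Proper G' c) where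

    colour-of-u⇒x : ∀ w → c (⇑ w) ≡ c u → w ≡ x
    colour-of-u⇒x w cw≡cu with w ≟ x
    ... | yes w≡x = w≡x
    ... | no w≢x = ⊥-elim (proper u (⇑ w) (u∼⇑ w≢x) (sym cw≡cu))

    colour-of-v⇒y : ∀ w → c (⇑ w) ≡ c v → w ≡ y
    colour-of-v⇒y w cw≡cv with w ≟ y
    ... | yes w≡y = w≡y
    ... | no w≢y = ⊥-elim (proper v (⇑ w) (v∼⇑ w≢y) (sym cw≡cv))

    -- Only x can have the colour of u; recolouring it like v (only y has
    -- that colour, and x ≁ y) frees the colour of u.
    recolour : ∀ {t} → Dec (t ≡ c u) → Fin (suc m)
    recolour (yes _) = c v
    recolour {t} (no _) = t

    restriction : Fin n → Fin (suc m)
    restriction w = recolour (c (⇑ w) ≟ c u)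

    restriction-proper : Proper G restriction
    restriction-proper p q p∼q = separated (c (⇑ p) ≟ c u) (c (⇑ q) ≟ c u)
      where
      ⇑p∼⇑q = ⇑-adj p∼q
      separated : (dp : Dec (c (⇑ p) ≡ c u)) (dq : Dec (c (⇑ q) ≡ c u)) → recolour dp ≢ recolour dq
      separated (yes cp≡cu) (yes cq≡cu) _ = proper (⇑ p) (⇑ q) ⇑p∼⇑q (trans cp≡cu (sym cq≡cu))
      separated (yes cp≡cu) (no _) cv≡cq with colour-of-u⇒x p cp≡cu | colour-of-v⇒y q (sym cv≡cq)
      ... | refl | refl = not-¬ p∼q x≁y
      separated (no _) (yes cq≡cu) cp≡cv with colour-of-v⇒y p cp≡cv | colour-of-u⇒x q cq≡cu
      ... | refl | refl = not-¬ p∼q (≁-sym G x≁y)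
      separated (no _) (no _) = proper (⇑ p) (⇑ q) ⇑p∼⇑q

    restriction-misses-u : ∀ w → c u ≢ restriction w
    restriction-misses-u w = avoids (c (⇑ w) ≟ c u)
      where
      avoids : (d : Dec (c (⇑ w) ≡ c u)) → c u ≢ recolour d
      avoids (yes cw≡cu) cu≡cv with colour-of-u⇒x w cw≡cu
      ... | refl = x≢y (colour-of-v⇒y x (trans cw≡cu cu≡cv))
      avoids (no cw≢cu) = cw≢cu ∘ sym

  restrict-colourable : ∀ {m} → Colourable G' (suc m) → Colourable G m
  restrict-colourable (c , proper) =
    missing-colour⇒colourable G (restriction c proper) (restriction-proper c proper) (c u)
      (restriction-misses-u c proper)

  χ-extend : ∀ {k} → IsChromaticNumber G k → Colourable G' (suc k) → IsChromaticNumber G' (suc k)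
  χ-extend {k} (_ , minimal) colourable = colourable , bound
    where
    bound : ∀ m → Colourable G' m → suc k ≤ m
    bound ℕ.zero (c , _) with c u
    ... | ()
    bound (suc m) colourable' = s≤s (minimal m (restrict-colourable colourable'))

  no-induced2K2-at-u : ∀ b c d → ¬ Induced2K2 G' u b c d
  no-induced2K2-at-u u _ _ (induced2K2 () _ _ _ _ _)
  no-induced2K2-at-u v _ _ (induced2K2 () _ _ _ _ _)
  no-induced2K2-at-u (⇑ _) u _ (induced2K2 _ c∼d _ u≁d _ _) = not-¬ c∼d u≁d
  no-induced2K2-at-u (⇑ _) v u (induced2K2 _ () _ _ _ _)
  no-induced2K2-at-u (⇑ _) v v (induced2K2 _ () _ _ _ _)
  no-induced2K2-at-u (⇑ b) v (⇑ d) (induced2K2 _ _ _ u≁d b≁v b≁d) with u≁⇑⁻ u≁d | v≁⇑⁻ (≁-sym G' {⇑ b} {v} b≁v)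
  ... | refl | refl = not-¬ yx-adj b≁d
  no-induced2K2-at-u (⇑ _) (⇑ c) u (induced2K2 _ c∼u u≁c _ _ _) = not-¬ c∼u (≁-sym G' {u} {⇑ c} u≁c)
  no-induced2K2-at-u (⇑ b) (⇑ c) v (induced2K2 _ _ u≁c _ b≁c b≁v) with u≁⇑⁻ u≁c | v≁⇑⁻ (≁-sym G' {⇑ b} {v} b≁v)
  ... | refl | refl = not-¬ yx-adj b≁c
  no-induced2K2-at-u (⇑ _) (⇑ c) (⇑ d) (induced2K2 _ c∼d u≁c u≁d _ _) with u≁⇑⁻ u≁c | u≁⇑⁻ u≁d
  ... | refl | refl = not-¬ c∼d (irrefl G' (⇑ c))

  no-induced2K2-at-v : ∀ b c d → ¬ Induced2K2 G' v b c d
  no-induced2K2-at-v u _ _ (induced2K2 () _ _ _ _ _)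
  no-induced2K2-at-v v _ _ (induced2K2 () _ _ _ _ _)
  no-induced2K2-at-v (⇑ _) v _ (induced2K2 _ c∼d _ v≁d _ _) = not-¬ c∼d v≁d
  no-induced2K2-at-v (⇑ _) u u (induced2K2 _ () _ _ _ _)
  no-induced2K2-at-v (⇑ _) u v (induced2K2 _ () _ _ _ _)
  no-induced2K2-at-v (⇑ b) u (⇑ d) (induced2K2 _ _ _ v≁d b≁u b≁d) with v≁⇑⁻ v≁d | u≁⇑⁻ (≁-sym G' {⇑ b} {u} b≁u)
  ... | refl | refl = not-¬ xy-adj b≁d
  no-induced2K2-at-v (⇑ _) (⇑ c) v (induced2K2 _ c∼v v≁c _ _ _) = not-¬ c∼v (≁-sym G' {v} {⇑ c} v≁c)
  no-induced2K2-at-v (⇑ b) (⇑ c) u (induced2K2 _ _ v≁c _ b≁c b≁u) with v≁⇑⁻ v≁c | u≁⇑⁻ (≁-sym G' {⇑ b} {u} b≁u)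
  ... | refl | refl = not-¬ xy-adj b≁c
  no-induced2K2-at-v (⇑ _) (⇑ c) (⇑ d) (induced2K2 _ c∼d v≁c v≁d _ _) with v≁⇑⁻ v≁c | v≁⇑⁻ v≁d
  ... | refl | refl = not-¬ c∼d (irrefl G' (⇑ c))

  anticomplete-⇑⁻ : ∀ {r s a b} → AnticompleteTo G' (⇑ r) (⇑ s) (⇑ a) (⇑ b) → AnticompleteTo G r s a b
  anticomplete-⇑⁻ (r≁a , r≁b , s≁a , s≁b) = ⇑-nonadj⁻ r≁a , ⇑-nonadj⁻ r≁b , ⇑-nonadj⁻ s≁a , ⇑-nonadj⁻ s≁b

  xyEdge-anticomplete : ∀ {a b p q} → Induced2K2 G' (⇑ a) (⇑ b) p q → IsXY a b →
    AnticompleteTo G' p q (⇑ x) (⇑ y)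
  xyEdge-anticomplete k (inj₁ (refl , refl)) = induced2K2⇒anticomplete k
  xyEdge-anticomplete k (inj₂ (refl , refl)) = induced2K2⇒anticomplete (induced2K2-flip k)

  xyEdge-not-anticomplete : ∀ {c d} → IsXY c d → ¬ AnticompleteTo G' (⇑ c) (⇑ d) (⇑ x) (⇑ y)
  xyEdge-not-anticomplete (inj₁ (refl , refl)) (_ , x≁y' , _) = not-¬ xy-adj x≁y'
  xyEdge-not-anticomplete (inj₂ (refl , refl)) (y≁x , _) = not-¬ yx-adj y≁x

  no-induced2K2-inside : TwoK2Free G → NoEdgeAnticompleteTo G x y →
    ∀ a b c d → ¬ Induced2K2 G' (⇑ a) (⇑ b) (⇑ c) (⇑ d)
  no-induced2K2-inside free noAnti a b c d k@(induced2K2 a∼b c∼d a≁c a≁d b≁c b≁d)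
    with ⇑-adj⁻ a∼b | ⇑-adj⁻ c∼d
  ... | inj₁ ab | inj₁ cd =
    free a b c d (ab , cd , ⇑-nonadj⁻ a≁c , ⇑-nonadj⁻ a≁d , ⇑-nonadj⁻ b≁c , ⇑-nonadj⁻ b≁d)
  ... | inj₁ ab | inj₂ cd = noAnti a b ab (anticomplete-⇑⁻ {a} {b} (xyEdge-anticomplete (induced2K2-swap k) cd))
  ... | inj₂ ab | inj₁ cd = noAnti c d cd (anticomplete-⇑⁻ {c} {d} (xyEdge-anticomplete k ab))
  ... | inj₂ ab | inj₂ cd = xyEdge-not-anticomplete cd (xyEdge-anticomplete k ab)

  twoK2Free-extend : TwoK2Free G → NoEdgeAnticompleteTo G x y → TwoK2Free G'
  twoK2Free-extend free noAnti = ¬induced2K2⇒twoK2Free no2K2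
    where
    no2K2 : ∀ a b c d → ¬ Induced2K2 G' a b c d
    no2K2 u b c d = no-induced2K2-at-u b c d
    no2K2 v b c d = no-induced2K2-at-v b c d
    no2K2 (⇑ a) u c d = no-induced2K2-at-u (⇑ a) c d ∘ induced2K2-flip
    no2K2 (⇑ a) v c d = no-induced2K2-at-v (⇑ a) c d ∘ induced2K2-flip
    no2K2 (⇑ a) (⇑ b) u d = no-induced2K2-at-u d (⇑ a) (⇑ b) ∘ induced2K2-swap
    no2K2 (⇑ a) (⇑ b) v d = no-induced2K2-at-v d (⇑ a) (⇑ b) ∘ induced2K2-swap
    no2K2 (⇑ a) (⇑ b) (⇑ c) u = no-induced2K2-at-u (⇑ c) (⇑ a) (⇑ b) ∘ induced2K2-flip ∘ induced2K2-swap
    no2K2 (⇑ a) (⇑ b) (⇑ c) v = no-induced2K2-at-v (⇑ c) (⇑ a) (⇑ b) ∘ induced2K2-flip ∘ induced2K2-swap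
    no2K2 (⇑ a) (⇑ b) (⇑ c) (⇑ d) = no-induced2K2-inside free noAnti a b c d

theorem8 : ∀ (k : ℕ) → 1 ≤ k → ∀ (n : ℕ) (G : Graph n)
    (β : Fin n → Fin k) (γ : Fin n → Fin (suc k)) (x y : Fin n) →
    Proper G β → KempeFrozen G γ →
    adj G x y ≡ false → β x ≢ β y →
    (γ x ≢ γ y ⊎ IsColourClassPair γ x y) →
    Colourable (extend G x y) (suc k) ×
    Σ (Fin (suc (suc n)) → Fin (suc (suc k))) (λ δ → KempeFrozen (extend G x y) δ) ×
    ¬ FormsKempeClass (extend G x y) (suc (suc k)) ×
    (IsChromaticNumber G k → IsChromaticNumber (extend G x y) (suc k)) ×
    (TwoK2Free G →
      (γ x ≢ γ y → ∀ (r s : Fin n) → adj G r s ≡ true →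
        ¬ (adj G r x ≡ false × adj G r y ≡ false × adj G s x ≡ false × adj G s y ≡ false)) →
      TwoK2Free (extend G x y))
theorem8 k _ n G β γ x y β-proper γ-frozen x≁y βx≢βy cases =
  colourable , frozen , ¬kempeClass , (λ χ → χ-extend χ colourable) ,
  λ free noAnti → twoK2Free-extend free (noEdgeAnticomplete cases noAnti)
  where
  open Extension G (βx≢βy ∘ cong β) x≁y

  colourable : Colourable G' (suc k)
  colourable = lift₀ β , lift₀-proper β-proper βx≢βy

  frozen : Σ (Fin (suc (suc n)) → Fin (suc (suc k))) (KempeFrozen G')
  frozen = [ (λ γx≢γy → lift₀ γ , frozen-lift₀ γ-frozen γx≢γy)
           , (λ class → classColouring γ , frozen-classColouring γ-frozen class) ]′ cases

  ¬kempeClass : ¬ FormsKempeClass G' (suc (suc k))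
  ¬kempeClass = frozen⇒¬kempeClass (proj₂ frozen) (suc ∘ lift₀ β)
    (λ a b a∼b → proj₂ colourable a b a∼b ∘ suc-injective) zero (λ _ ())

  noEdgeAnticomplete : (γ x ≢ γ y ⊎ IsColourClassPair γ x y) →
    (γ x ≢ γ y → NoEdgeAnticompleteTo G x y) → NoEdgeAnticompleteTo G x y
  noEdgeAnticomplete (inj₁ γx≢γy) noAnti = noAnti γx≢γy
  noEdgeAnticomplete (inj₂ class) _ = classPair⇒noEdgeAnticomplete γ-frozen class
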